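{- Let $m\geq n$ and let $S$ be a subset of $[m]$ with $|S|\geq n$. Let $S_0\supseteq S_1\supseteq\cdots\supseteq S_k$ be subsets of $[m]$ with $S_0=[m]$, $S_k=S$, and $|S_i\setminus S_{i+1}|=1$ for $0\le i<k$. Then $$\phi_S^{[m]}=\phi_{S_k}^{S_{k-1}}\circ\cdots\circ\phi_{S_1}^{S_0}.$$
   Context: For $U\subseteq[m]$ with $|U|\geq n$, $\mathcal{F}_n^{U}$ denotes the set of $n$-element subsets of $U$. For subsets $S\subseteq S'\subseteq[m]$ with $|S|\geq n$, the concentration map $\phi_S^{S'}:\mathcal{F}_n^{S'}\to\mathcal{F}_n^{S}$ sends $A$ to the union of $A\cap S$ with the set of the $|A\setminus S|$ smallest elements of $S\setminus A$. -}

module Defs where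

open import Data.Nat using (ℕ; zero; suc)
open import Data.Bool using (true; false)
open import Data.Vec using ([]; _∷_)
open import Data.Fin using (Fin; zero; suc)
open import Data.Fin.Subset using (Subset; inside; outside; _∩_; _∪_; _─_; ∣_∣)

-- smallest k T : the set of the k smallest elements of T
-- (all of T if |T| < k; in this lemma always |T| ≥ k).
-- Fin m is ordered by its natural order (index 0 is smallest).
smallest : ∀ {m} → ℕ → Subset m → Subset m
smallest k [] = []
smallest zero (x ∷ xs) = outside ∷ smallest zero xs
smallest (suc k) (true ∷ xs) = inside ∷ smallest k xs
smallest (suc k) (false ∷ xs) = outside ∷ smallest (suc k) xs

-- Concentration map φ_S^{S'} (its formula does not depend on S'):
-- A ↦ (A ∩ S) ∪ (the |A ∖ S| smallest elements of S ∖ A).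
φ : ∀ {m} → (S : Subset m) → Subset m → Subset m
φ S A = (A ∩ S) ∪ smallest ∣ A ─ S ∣ (S ─ A)

chainComp : ∀ {m} (k : ℕ) → (Fin (suc k) → Subset m) → Subset m → Subset m
chainComp zero Ss A = A
chainComp (suc k) Ss A = chainComp k (λ i → Ss (suc i)) (φ (Ss (suc zero)) A)

{-# OPTIONS --safe #-}
-- Write pad k S A for (A ∩ S) ∪ (the k smallest elements of S ∖ A), so that φ S A = pad |A ∖ S| S A.
-- If S ⊆ T, the padding elements that pad k T A takes from T ∖ A and that lie in S form an initial
-- segment of S ∖ A; hence padding in T and then in S is a single padding in S:
-- pad j S (pad k T A) = pad (h + j) S A, where h counts those elements. For k = |A ∖ T| ≤ |T ∖ A|
-- (that is, |A| ≤ |T|) counting gives h + |φ T A ∖ S| = |A ∖ S|, so φ S ∘ φ T = φ S on such A.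
-- Induction along the chain, starting from φ [m] = id, proves the theorem; it only uses the
-- inclusions, not that each step removes a single element (nor m ≥ n).
module Submission where

open import Defs
open import Data.Nat using (ℕ; zero; suc; _+_; _≤_; _≥_; z≤n; s≤s)
open import Data.Nat.Properties using (+-suc; +-cancelʳ-≡; +-cancelˡ-≤; +-monoˡ-≤; ≤-trans)
open import Data.Vec using ([]; _∷_)
open import Data.Fin using (Fin; zero; suc; fromℕ; inject₁)
open import Data.Fin.Subset using (Subset; inside; outside; ⊤; ⊥; _⊆_; _∩_; _∪_; _─_; ∣_∣)
open import Data.Fin.Subset.Properties
  using (drop-∷-⊆; p⊆q⇒∣p∣≤∣q∣; ∣⊥∣≡0; p─⊤≡⊥; ∩-zeroˡ; ∩-identityʳ; ∪-identityʳ)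
open import Data.Vec.Base using (here)
open import Relation.Nullary using (¬_)
open import Data.Empty using (⊥-elim)
open import Relation.Binary.PropositionalEquality using (_≡_; refl; sym; trans; cong; cong₂; subst; module ≡-Reasoning)

private
  variable
    m : ℕ

smallest-zero : (X : Subset m) → smallest 0 X ≡ ⊥
smallest-zero []      = refl
smallest-zero (_ ∷ X) = cong (outside ∷_) (smallest-zero X)

∣smallest-zero∩∣≡0 : (X S : Subset m) → ∣ smallest 0 X ∩ S ∣ ≡ 0
∣smallest-zero∩∣≡0 {m} X S =
  trans (cong (λ Y → ∣ Y ∩ S ∣) (smallest-zero X)) (trans (cong ∣_∣ (∩-zeroˡ S)) (∣⊥∣≡0 m))

-- A one-pass scan equal to (A ∩ S) ∪ smallest k (S ─ A) (∩∪smallest≡pad); unlike that expression it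
-- reduces on the heads of S and A without a case split on k.
pad : ℕ → Subset m → Subset m → Subset m
pad k       []            []            = []
pad k       (s ∷ S)       (inside ∷ A)  = s ∷ pad k S A
pad k       (outside ∷ S) (outside ∷ A) = outside ∷ pad k S A
pad zero    (inside ∷ S)  (outside ∷ A) = outside ∷ pad zero S A
pad (suc k) (inside ∷ S)  (outside ∷ A) = inside ∷ pad k S A

∩∪smallest≡pad : ∀ k (S A : Subset m) → (A ∩ S) ∪ smallest k (S ─ A) ≡ pad k S A
∩∪smallest≡pad k       []            []            = refl
∩∪smallest≡pad zero    (inside ∷ S)  (inside ∷ A)  = cong (inside ∷_) (∩∪smallest≡pad zero S A)
∩∪smallest≡pad (suc k) (inside ∷ S)  (inside ∷ A)  = cong (inside ∷_) (∩∪smallest≡pad (suc k) S A)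
∩∪smallest≡pad zero    (outside ∷ S) (inside ∷ A)  = cong (outside ∷_) (∩∪smallest≡pad zero S A)
∩∪smallest≡pad (suc k) (outside ∷ S) (inside ∷ A)  = cong (outside ∷_) (∩∪smallest≡pad (suc k) S A)
∩∪smallest≡pad zero    (outside ∷ S) (outside ∷ A) = cong (outside ∷_) (∩∪smallest≡pad zero S A)
∩∪smallest≡pad (suc k) (outside ∷ S) (outside ∷ A) = cong (outside ∷_) (∩∪smallest≡pad (suc k) S A)
∩∪smallest≡pad zero    (inside ∷ S)  (outside ∷ A) = cong (outside ∷_) (∩∪smallest≡pad zero S A)
∩∪smallest≡pad (suc k) (inside ∷ S)  (outside ∷ A) = cong (inside ∷_) (∩∪smallest≡pad k S A)

φ≡pad : (S A : Subset m) → φ S A ≡ pad ∣ A ─ S ∣ S A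
φ≡pad S A = ∩∪smallest≡pad ∣ A ─ S ∣ S A

inside∷⊈outside∷ : {S T : Subset m} → ¬ (inside ∷ S ⊆ outside ∷ T)
inside∷⊈outside∷ S⊆T with () ← S⊆T here

pad-pad : ∀ j k (T S A : Subset m) → S ⊆ T →
          pad j S (pad k T A) ≡ pad (∣ smallest k (T ─ A) ∩ S ∣ + j) S A
pad-pad j k       []            []            []            _   = refl
pad-pad j k       (outside ∷ T) (inside ∷ S)  _             S⊆T = ⊥-elim (inside∷⊈outside∷ S⊆T)
pad-pad j zero    (inside ∷ T)  (s ∷ S)       (inside ∷ A)  S⊆T = cong (s ∷_) (pad-pad j zero T S A (drop-∷-⊆ S⊆T))
pad-pad j (suc k) (inside ∷ T)  (s ∷ S)       (inside ∷ A)  S⊆T = cong (s ∷_) (pad-pad j (suc k) T S A (drop-∷-⊆ S⊆T))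
pad-pad j zero    (outside ∷ T) (outside ∷ S) (inside ∷ A)  S⊆T = cong (outside ∷_) (pad-pad j zero T S A (drop-∷-⊆ S⊆T))
pad-pad j (suc k) (outside ∷ T) (outside ∷ S) (inside ∷ A)  S⊆T = cong (outside ∷_) (pad-pad j (suc k) T S A (drop-∷-⊆ S⊆T))
pad-pad j zero    (outside ∷ T) (outside ∷ S) (outside ∷ A) S⊆T = cong (outside ∷_) (pad-pad j zero T S A (drop-∷-⊆ S⊆T))
pad-pad j (suc k) (outside ∷ T) (outside ∷ S) (outside ∷ A) S⊆T = cong (outside ∷_) (pad-pad j (suc k) T S A (drop-∷-⊆ S⊆T))
pad-pad j zero    (inside ∷ T)  (outside ∷ S) (outside ∷ A) S⊆T = cong (outside ∷_) (pad-pad j zero T S A (drop-∷-⊆ S⊆T))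
pad-pad j (suc k) (inside ∷ T)  (outside ∷ S) (outside ∷ A) S⊆T = cong (outside ∷_) (pad-pad j k T S A (drop-∷-⊆ S⊆T))
pad-pad j (suc k) (inside ∷ T)  (inside ∷ S)  (outside ∷ A) S⊆T = cong (inside ∷_) (pad-pad j k T S A (drop-∷-⊆ S⊆T))
pad-pad j zero    (inside ∷ T)  (inside ∷ S)  (outside ∷ A) S⊆T =
  trans (step j) (cong (λ c → pad (c + j) (inside ∷ S) (outside ∷ A)) (sym hits≡0))
  where
  hits≡0 : ∣ smallest 0 (T ─ A) ∩ S ∣ ≡ 0
  hits≡0 = ∣smallest-zero∩∣≡0 (T ─ A) S
  tail : ∀ i → pad i S (pad 0 T A) ≡ pad i S A
  tail i = trans (pad-pad i 0 T S A (drop-∷-⊆ S⊆T)) (cong (λ c → pad (c + i) S A) hits≡0)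
  step : ∀ i → pad i (inside ∷ S) (outside ∷ pad 0 T A) ≡ pad i (inside ∷ S) (outside ∷ A)
  step zero    = cong (outside ∷_) (tail 0)
  step (suc i) = cong (inside ∷_) (tail i)

-- pad k T A ─ S is (A ∩ T) ─ S plus the padding elements outside S, and A ─ S is (A ∩ T) ─ S plus A ─ T.
pad-─-balance : ∀ k (T S A : Subset m) → S ⊆ T → k ≤ ∣ T ─ A ∣ →
                ∣ smallest k (T ─ A) ∩ S ∣ + ∣ pad k T A ─ S ∣ + ∣ A ─ T ∣ ≡ ∣ A ─ S ∣ + k
pad-─-balance _       []            []            []            _   z≤n = refl
pad-─-balance k       (outside ∷ T) (inside ∷ S)  _             S⊆T _   = ⊥-elim (inside∷⊈outside∷ S⊆T)
pad-─-balance zero    (inside ∷ T)  (inside ∷ S)  (inside ∷ A)  S⊆T k≤ = pad-─-balance zero T S A (drop-∷-⊆ S⊆T) k≤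
pad-─-balance (suc k) (inside ∷ T)  (inside ∷ S)  (inside ∷ A)  S⊆T k≤ = pad-─-balance (suc k) T S A (drop-∷-⊆ S⊆T) k≤
pad-─-balance zero    (inside ∷ T)  (outside ∷ S) (inside ∷ A)  S⊆T k≤ =
  trans (cong (_+ ∣ A ─ T ∣) (+-suc _ ∣ pad 0 T A ─ S ∣)) (cong suc (pad-─-balance zero T S A (drop-∷-⊆ S⊆T) k≤))
pad-─-balance (suc k) (inside ∷ T)  (outside ∷ S) (inside ∷ A)  S⊆T k≤ =
  trans (cong (_+ ∣ A ─ T ∣) (+-suc _ ∣ pad (suc k) T A ─ S ∣)) (cong suc (pad-─-balance (suc k) T S A (drop-∷-⊆ S⊆T) k≤))
pad-─-balance zero    (outside ∷ T) (outside ∷ S) (inside ∷ A)  S⊆T k≤ =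
  trans (+-suc _ ∣ A ─ T ∣) (cong suc (pad-─-balance zero T S A (drop-∷-⊆ S⊆T) k≤))
pad-─-balance (suc k) (outside ∷ T) (outside ∷ S) (inside ∷ A)  S⊆T k≤ =
  trans (+-suc _ ∣ A ─ T ∣) (cong suc (pad-─-balance (suc k) T S A (drop-∷-⊆ S⊆T) k≤))
pad-─-balance zero    (outside ∷ T) (outside ∷ S) (outside ∷ A) S⊆T k≤ = pad-─-balance zero T S A (drop-∷-⊆ S⊆T) k≤
pad-─-balance (suc k) (outside ∷ T) (outside ∷ S) (outside ∷ A) S⊆T k≤ = pad-─-balance (suc k) T S A (drop-∷-⊆ S⊆T) k≤
pad-─-balance zero    (inside ∷ T)  (outside ∷ S) (outside ∷ A) S⊆T _  = pad-─-balance zero T S A (drop-∷-⊆ S⊆T) z≤n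
pad-─-balance (suc k) (inside ∷ T)  (outside ∷ S) (outside ∷ A) S⊆T (s≤s k≤) =
  trans (cong (_+ ∣ A ─ T ∣) (+-suc _ ∣ pad k T A ─ S ∣))
        (trans (cong suc (pad-─-balance k T S A (drop-∷-⊆ S⊆T) k≤)) (sym (+-suc ∣ A ─ S ∣ k)))
pad-─-balance zero    (inside ∷ T)  (inside ∷ S)  (outside ∷ A) S⊆T _  = pad-─-balance zero T S A (drop-∷-⊆ S⊆T) z≤n
pad-─-balance (suc k) (inside ∷ T)  (inside ∷ S)  (outside ∷ A) S⊆T (s≤s k≤) =
  trans (cong suc (pad-─-balance k T S A (drop-∷-⊆ S⊆T) k≤)) (sym (+-suc ∣ A ─ S ∣ k))

∣p∣+∣q─p∣≡∣q∣+∣p─q∣ : (p q : Subset m) → ∣ p ∣ + ∣ q ─ p ∣ ≡ ∣ q ∣ + ∣ p ─ q ∣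
∣p∣+∣q─p∣≡∣q∣+∣p─q∣ []            []            = refl
∣p∣+∣q─p∣≡∣q∣+∣p─q∣ (inside ∷ p)  (inside ∷ q)  = cong suc (∣p∣+∣q─p∣≡∣q∣+∣p─q∣ p q)
∣p∣+∣q─p∣≡∣q∣+∣p─q∣ (inside ∷ p)  (outside ∷ q) = trans (cong suc (∣p∣+∣q─p∣≡∣q∣+∣p─q∣ p q)) (sym (+-suc ∣ q ∣ ∣ p ─ q ∣))
∣p∣+∣q─p∣≡∣q∣+∣p─q∣ (outside ∷ p) (inside ∷ q)  = trans (+-suc ∣ p ∣ ∣ q ─ p ∣) (cong suc (∣p∣+∣q─p∣≡∣q∣+∣p─q∣ p q))
∣p∣+∣q─p∣≡∣q∣+∣p─q∣ (outside ∷ p) (outside ∷ q) = ∣p∣+∣q─p∣≡∣q∣+∣p─q∣ p q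

∣p∣≤∣q∣⇒∣p─q∣≤∣q─p∣ : {p q : Subset m} → ∣ p ∣ ≤ ∣ q ∣ → ∣ p ─ q ∣ ≤ ∣ q ─ p ∣
∣p∣≤∣q∣⇒∣p─q∣≤∣q─p∣ {p = p} {q} ∣p∣≤∣q∣ = +-cancelˡ-≤ ∣ q ∣ (∣ p ─ q ∣) (∣ q ─ p ∣)
  (subst (_≤ ∣ q ∣ + ∣ q ─ p ∣) (∣p∣+∣q─p∣≡∣q∣+∣p─q∣ p q) (+-monoˡ-≤ ∣ q ─ p ∣ ∣p∣≤∣q∣))

φ-φ : (S T A : Subset m) → S ⊆ T → ∣ A ∣ ≤ ∣ T ∣ → φ S (φ T A) ≡ φ S A
φ-φ {m} S T A S⊆T ∣A∣≤∣T∣ = begin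
  φ S (φ T A)                     ≡⟨ cong (φ S) (φ≡pad T A) ⟩
  φ S B                           ≡⟨ φ≡pad S B ⟩
  pad (∣ B ─ S ∣) S B             ≡⟨ pad-pad (∣ B ─ S ∣) k T S A S⊆T ⟩
  pad (hits + ∣ B ─ S ∣) S A      ≡⟨ cong (λ i → pad i S A) hits+∣B─S∣≡∣A─S∣ ⟩
  pad (∣ A ─ S ∣) S A             ≡⟨ sym (φ≡pad S A) ⟩
  φ S A                           ∎
  where
  open ≡-Reasoning
  k : ℕ
  k = ∣ A ─ T ∣
  B : Subset m
  B = pad k T A
  hits : ℕ
  hits = ∣ smallest k (T ─ A) ∩ S ∣
  hits+∣B─S∣≡∣A─S∣ : hits + ∣ B ─ S ∣ ≡ ∣ A ─ S ∣
  hits+∣B─S∣≡∣A─S∣ = +-cancelʳ-≡ k _ _ (pad-─-balance k T S A S⊆T (∣p∣≤∣q∣⇒∣p─q∣≤∣q─p∣ {p = A} {T} ∣A∣≤∣T∣))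

φ-⊤ : (A : Subset m) → φ ⊤ A ≡ A
φ-⊤ {m} A = begin
  (A ∩ ⊤) ∪ smallest ∣ A ─ ⊤ ∣ (⊤ ─ A) ≡⟨ cong (λ k → (A ∩ ⊤) ∪ smallest k (⊤ ─ A)) ∣A─⊤∣≡0 ⟩
  (A ∩ ⊤) ∪ smallest 0 (⊤ ─ A)         ≡⟨ cong₂ _∪_ (∩-identityʳ A) (smallest-zero (⊤ ─ A)) ⟩
  A ∪ ⊥                                ≡⟨ ∪-identityʳ A ⟩
  A                                    ∎
  where
  open ≡-Reasoning
  ∣A─⊤∣≡0 : ∣ A ─ ⊤ ∣ ≡ 0
  ∣A─⊤∣≡0 = trans (cong ∣_∣ (p─⊤≡⊥ A)) (∣⊥∣≡0 m)

chainComp-last : ∀ k (Ss : Fin (suc (suc k)) → Subset m) (A : Subset m) →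
                 chainComp (suc k) Ss A ≡ φ (Ss (fromℕ (suc k))) (chainComp k (λ i → Ss (inject₁ i)) A)
chainComp-last zero    Ss A = refl
chainComp-last (suc k) Ss A = chainComp-last k (λ i → Ss (suc i)) (φ (Ss (suc zero)) A)

chainComp≡φ : ∀ k (Ss : Fin (suc k) → Subset m) → Ss zero ≡ ⊤ →
              (∀ (i : Fin k) → Ss (suc i) ⊆ Ss (inject₁ i)) →
              (A : Subset m) → ∣ A ∣ ≤ ∣ Ss (fromℕ k) ∣ → chainComp k Ss A ≡ φ (Ss (fromℕ k)) A
chainComp≡φ zero Ss Ss₀≡⊤ _ A _ = sym (trans (cong (λ S → φ S A) Ss₀≡⊤) (φ-⊤ A))
chainComp≡φ {m} (suc k) Ss Ss₀≡⊤ decreasing A ∣A∣≤∣S∣ = begin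
  chainComp (suc k) Ss A         ≡⟨ chainComp-last k Ss A ⟩
  φ S (chainComp k Ss′ A)        ≡⟨ cong (φ S) (chainComp≡φ k Ss′ Ss₀≡⊤ (λ i → decreasing (inject₁ i)) A ∣A∣≤∣T∣) ⟩
  φ S (φ T A)                    ≡⟨ φ-φ S T A S⊆T ∣A∣≤∣T∣ ⟩
  φ S A                          ∎
  where
  open ≡-Reasoning
  Ss′ : Fin (suc k) → Subset m
  Ss′ i = Ss (inject₁ i)
  S T : Subset m
  S = Ss (fromℕ (suc k))
  T = Ss′ (fromℕ k)
  S⊆T : S ⊆ T
  S⊆T = decreasing (fromℕ k)
  ∣A∣≤∣T∣ : ∣ A ∣ ≤ ∣ T ∣
  ∣A∣≤∣T∣ = ≤-trans ∣A∣≤∣S∣ (p⊆q⇒∣p∣≤∣q∣ S⊆T)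

lemma4p1 : (m n : ℕ) → m ≥ n → (S : Subset m) → ∣ S ∣ ≥ n →
    (k : ℕ) (Ss : Fin (suc k) → Subset m) →
    Ss zero ≡ ⊤ → Ss (fromℕ k) ≡ S →
    (∀ (i : Fin k) → Ss (suc i) ⊆ Ss (inject₁ i)) →
    (∀ (i : Fin k) → ∣ Ss (inject₁ i) ─ Ss (suc i) ∣ ≡ 1) →
    (A : Subset m) → ∣ A ∣ ≡ n →
    φ S A ≡ chainComp k Ss A
lemma4p1 _ _ _ _ n≤∣S∣ k Ss Ss₀≡⊤ refl decreasing _ A refl =
  sym (chainComp≡φ k Ss Ss₀≡⊤ decreasing A n≤∣S∣)
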